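{- Let $n\geq 2$ be an integer and $k$ an integer. If $s_k(n)$ is prime, then $k=(p-1)/2$ for some odd prime $p$ (i.e. $2k+1$ is an odd prime).
   Context: For an integer $n$, the sequence $(s_k(n))_{k\in\mathbb{Z}}$ is defined by $s_0(n)=1$, $s_1(n)=n+1$ and $s_{k+2}(n)=n\,s_{k+1}(n)-s_k(n)$ for all $k\in\mathbb{Z}$. -}

module Defs where

open import Data.Nat using (ℕ; zero; suc)
open import Data.Integer using (ℤ; +_; -[1+_]; _+_; _-_; _*_; 1ℤ)
open import Data.Product using (_×_; _,_; proj₁)

fwd : ℤ → ℕ → ℤ × ℤ
fwd n zero = 1ℤ , n + 1ℤ
fwd n (suc m) with fwd n m
... | (a , b) = b , n * b - a

-- pairs (s_{-m}(n), s_{-m+1}(n)) for m ≥ 0, via s_k = n s_{k+1} - s_{k+2}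
bwd : ℤ → ℕ → ℤ × ℤ
bwd n zero = 1ℤ , n + 1ℤ
bwd n (suc m) with bwd n m
... | (a , b) = n * a - b , a

s : ℤ → ℤ → ℤ
s (+ k) n = proj₁ (fwd n k)
s -[1+ k ] n = proj₁ (bwd n (suc k))

-- For n ≥ 2 the values s_k(n) are negative for k < 0 and increase strictly from s_0 = 1 for k ≥ 0.
-- Every solution of u_{j+2} = n u_{j+1} - u_j satisfies u_{j+2M} + u_j = V_M u_{j+M}, where V is the
-- companion Lucas sequence (V_0 = 2, V_1 = n), so a common divisor of u_0 and u_m divides every u_{bm}.
-- For the solution starting at s_{-a-1} = -s_a and m = 2a+1 this gives s_a ∣ s_k whenever 2a+1 ∣ 2k+1.
-- So if 2k+1 = (2a+1)(2b+1) with a, b ≥ 1, then 1 < s_a < s_k is a proper divisor of s_k.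

module Submission where

open import Defs
open import Data.Nat using (ℕ)
open import Data.Nat.Primality using (Prime)
open import Data.Integer using (ℤ; +_; _+_; _*_; _≤_)
open import Data.Product using (Σ; _×_)
open import Relation.Binary.PropositionalEquality using (_≡_; _≢_)

open import Data.Nat as ℕ using (zero; suc; ⌊_/2⌋; parity; z<s)
import Data.Nat.Properties as ℕ
import Data.Nat.Tactic.RingSolver as ℕ-Solver
open import Data.Nat.Primality using (Composite; composite; prime; ¬prime[1]; prime⇒irreducible)
open import Data.Nat.Divisibility using (divides)
open import Data.Integer using (-[1+_]; -_; _-_; _<_; 0ℤ; 1ℤ; +<+; nonNegative)
import Data.Integer.Properties as ℤ
open import Data.Integer.Divisibility.Signed using (_∣_; ∣-refl; ∣m⇒∣-m; ∣n⇒∣m*n; ∣m+n∣n⇒∣m; ∣⇒∣ᵤ)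
open import Data.Integer.Tactic.RingSolver using (solve-∀)
open import Data.Parity using (1ℙ)
open import Data.Parity.Properties using (*-homo-*)
open import Data.Product using (_,_; proj₁; proj₂; ∃₂)
open import Data.Sum using (inj₁; inj₂)
open import Data.Empty using (⊥-elim)
open import Function using (_∘_)
open import Relation.Nullary using (¬_)
open import Relation.Binary.PropositionalEquality using (refl; sym; trans; cong; cong₂; subst; module ≡-Reasoning)

private variable
  n d : ℤ
  u : ℕ → ℤ

record Solution (n : ℤ) (u : ℕ → ℤ) : Set where
  constructor solution
  field recurrence : ∀ c → u (suc (suc c)) ≡ n * u (suc c) - u c

open Solution

-- Shifting by adding on the right keeps the recurrence definitional.
shift-solution : Solution n u → ∀ k → Solution n (λ c → u (c ℕ.+ k))
shift-solution sol k = solution λ c → recurrence sol (c ℕ.+ k)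

solution-backward : Solution n u → ∀ c → u c ≡ n * u (suc c) - u (suc (suc c))
solution-backward {n} {u} sol c =
  trans (x≡y-[y-x] (n * u (suc c)) (u c)) (cong (λ x → n * u (suc c) - x) (sym (recurrence sol c)))
  where
  x≡y-[y-x] : ∀ y x → x ≡ y - (y - x)
  x≡y-[y-x] = solve-∀

lucasV : ℤ → ℕ → ℤ
lucasV n zero = + 2
lucasV n (suc zero) = n
lucasV n (suc (suc M)) = n * lucasV n (suc M) - lucasV n M

doubling-step : ∀ {M} → Solution n u →
  u (suc M ℕ.+ suc M ℕ.+ 1) + u 1 ≡ lucasV n (suc M) * u (suc M ℕ.+ 1) →
  u (M ℕ.+ M ℕ.+ 2) + u 2 ≡ lucasV n M * u (M ℕ.+ 2) →
  u (suc (suc M) ℕ.+ suc (suc M)) + u 0 ≡ lucasV n (suc (suc M)) * u (suc (suc M))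
doubling-step {n} {u} {M} sol ih₁ ih₂ = begin
  u (suc (suc M) ℕ.+ suc (suc M)) + u 0
    ≡⟨ cong₂ _+_ (cong u (index-4 M)) (solution-backward sol 0) ⟩
  u (4 ℕ.+ w) + (n * u 1 - u 2)
    ≡⟨ cong (_+ (n * u 1 - u 2)) (recurrence sol (2 ℕ.+ w)) ⟩
  (n * u (3 ℕ.+ w) - u (2 ℕ.+ w)) + (n * u 1 - u 2)
    ≡⟨ regroup n (u (3 ℕ.+ w)) (u 1) (u (2 ℕ.+ w)) (u 2) ⟩
  n * (u (3 ℕ.+ w) + u 1) - (u (2 ℕ.+ w) + u 2)
    ≡⟨ cong₂ (λ x y → n * x - y) ih₁′ ih₂′ ⟩
  n * (lucasV n (suc M) * X) - lucasV n M * X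
    ≡⟨ factor n (lucasV n (suc M)) (lucasV n M) X ⟩
  lucasV n (suc (suc M)) * X ∎
  where
  open ≡-Reasoning
  w : ℕ
  w = M ℕ.+ M
  X : ℤ
  X = u (suc (suc M))
  index-4 : ∀ M → suc (suc M) ℕ.+ suc (suc M) ≡ 4 ℕ.+ (M ℕ.+ M)
  index-4 = ℕ-Solver.solve-∀
  index-3 : ∀ M → suc M ℕ.+ suc M ℕ.+ 1 ≡ 3 ℕ.+ (M ℕ.+ M)
  index-3 = ℕ-Solver.solve-∀
  index-2 : ∀ M → M ℕ.+ M ℕ.+ 2 ≡ 2 ℕ.+ (M ℕ.+ M)
  index-2 = ℕ-Solver.solve-∀
  ih₁′ : u (3 ℕ.+ w) + u 1 ≡ lucasV n (suc M) * X
  ih₁′ = trans (cong (λ i → u i + u 1) (sym (index-3 M)))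
    (trans ih₁ (cong (λ i → lucasV n (suc M) * u i) (ℕ.+-comm (suc M) 1)))
  ih₂′ : u (2 ℕ.+ w) + u 2 ≡ lucasV n M * X
  ih₂′ = trans (cong (λ i → u i + u 2) (sym (index-2 M)))
    (trans ih₂ (cong (λ i → lucasV n M * u i) (ℕ.+-comm M 2)))
  regroup : ∀ n a b c d → (n * a - c) + (n * b - d) ≡ n * (a + b) - (c + d)
  regroup = solve-∀
  factor : ∀ n a b x → n * (a * x) - b * x ≡ (n * a - b) * x
  factor = solve-∀

solution-doubling : ∀ M → Solution n u → u (M ℕ.+ M) + u 0 ≡ lucasV n M * u M
solution-doubling {u = u} zero sol = x+x≡2x (u 0)
  where
  x+x≡2x : ∀ x → x + x ≡ + 2 * x
  x+x≡2x = solve-∀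
solution-doubling {n} {u} (suc zero) sol = trans (cong (_+ u 0) (recurrence sol 0)) (y-x+x≡y (n * u 1) (u 0))
  where
  y-x+x≡y : ∀ y x → y - x + x ≡ y
  y-x+x≡y = solve-∀
solution-doubling (suc (suc M)) sol = doubling-step sol
  (solution-doubling (suc M) (shift-solution sol 1))
  (solution-doubling M (shift-solution sol 2))

solution-∣-multiples : ∀ {m} → Solution n u → d ∣ u 0 → d ∣ u m → ∀ b → d ∣ u (b ℕ.* m)
solution-∣-multiples {n} {u} {d} {m} sol d∣u₀ d∣uₘ b = proj₁ (consecutive b)
  where
  consecutive : ∀ b → (d ∣ u (b ℕ.* m)) × (d ∣ u (suc b ℕ.* m))
  consecutive zero = d∣u₀ , subst (λ i → d ∣ u i) (sym (ℕ.+-identityʳ m)) d∣uₘ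
  consecutive (suc b) = d∣u[bm+m] , subst (λ i → d ∣ u i) (ℕ.+-assoc m m (b ℕ.* m)) d∣u[bm+2m]
    where
    d∣u[bm] : d ∣ u (b ℕ.* m)
    d∣u[bm] = proj₁ (consecutive b)
    d∣u[bm+m] : d ∣ u (suc b ℕ.* m)
    d∣u[bm+m] = proj₂ (consecutive b)
    d∣u[bm+2m] : d ∣ u (m ℕ.+ m ℕ.+ b ℕ.* m)
    d∣u[bm+2m] = ∣m+n∣n⇒∣m
      (subst (d ∣_) (sym (solution-doubling m (shift-solution sol (b ℕ.* m)))) (∣n⇒∣m*n (lucasV n m) d∣u[bm+m]))
      d∣u[bm]

x≡ny-[ny-x] : ∀ n y x → x ≡ n * y - (n * y - x)
x≡ny-[ny-x] = solve-∀

-- For negative j the value s j n unfolds to n * s (j + + 1) n - s (j + + 2) n, the defining step of bwd.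
s-recurrence : ∀ n j → s (j + + 2) n ≡ n * s (j + + 1) n - s j n
s-recurrence n (+ m) rewrite ℕ.+-comm m 2 | ℕ.+-comm m 1 = refl
s-recurrence n -[1+ 0 ] = x≡ny-[ny-x] n 1ℤ (n + 1ℤ)
s-recurrence n -[1+ 1 ] = x≡ny-[ny-x] n (s -[1+ 0 ] n) 1ℤ
s-recurrence n -[1+ suc (suc k) ] = x≡ny-[ny-x] n (s -[1+ suc k ] n) (s -[1+ k ] n)

s-solution : ∀ n i → Solution n (λ c → s (i + + c) n)
s-solution n i = solution λ c → begin
  s (i + + (2 ℕ.+ c)) n                                  ≡⟨ cong (λ j → s j n) (shift-index 2 c) ⟩
  s ((i + + c) + + 2) n                                  ≡⟨ s-recurrence n (i + + c) ⟩
  n * s ((i + + c) + + 1) n - s (i + + c) n              ≡⟨ cong (λ j → n * s j n - s (i + + c) n) (sym (shift-index 1 c)) ⟩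
  n * s (i + + (1 ℕ.+ c)) n - s (i + + c) n              ∎
  where
  open ≡-Reasoning
  shift-index : ∀ k c → i + + (k ℕ.+ c) ≡ (i + + c) + + k
  shift-index k c = trans (cong (λ m → i + + m) (ℕ.+-comm k c)) (sym (ℤ.+-assoc i (+ c) (+ k)))

s-reflection : ∀ n k → s -[1+ k ] n ≡ - s (+ k) n
s-reflection n 0 = ny-[n+1]≡-1 n
  where
  ny-[n+1]≡-1 : ∀ n → n * 1ℤ - (n + 1ℤ) ≡ - 1ℤ
  ny-[n+1]≡-1 = solve-∀
s-reflection n 1 = trans (cong (λ x → n * x - 1ℤ) (s-reflection n 0)) (n[-1]-1≡-[n+1] n)
  where
  n[-1]-1≡-[n+1] : ∀ n → n * - 1ℤ - 1ℤ ≡ - (n + 1ℤ)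
  n[-1]-1≡-[n+1] = solve-∀
s-reflection n (suc (suc k)) =
  trans (cong₂ (λ x y → n * x - y) (s-reflection n (suc k)) (s-reflection n k)) (n[-x]-[-y]≡-[nx-y] n _ _)
  where
  n[-x]-[-y]≡-[nx-y] : ∀ n x y → n * - x - - y ≡ - (n * x - y)
  n[-x]-[-y]≡-[nx-y] = solve-∀

-[1+a]+[1+a+c]≡c : ∀ a c → -[1+ a ] + + (suc a ℕ.+ c) ≡ + c
-[1+a]+[1+a+c]≡c a c = trans (ℤ.⊖-≥ (ℕ.m≤m+n (suc a) c)) (cong +_ (ℕ.m+n∸m≡n (suc a) c))

s[a]∣s[a+b*[1+a+a]] : ∀ n a b → s (+ a) n ∣ s (+ (a ℕ.+ b ℕ.* suc (a ℕ.+ a))) n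
s[a]∣s[a+b*[1+a+a]] n a b = subst (λ j → s (+ a) n ∣ s j n) value
  (solution-∣-multiples {m = suc (a ℕ.+ a)} (s-solution n -[1+ a ]) d∣s₋ₐ₋₁ d∣sₐ (suc b))
  where
  d∣s₋ₐ₋₁ : s (+ a) n ∣ s -[1+ a ] n
  d∣s₋ₐ₋₁ = subst (s (+ a) n ∣_) (sym (s-reflection n a)) (∣m⇒∣-m ∣-refl)
  d∣sₐ : s (+ a) n ∣ s (-[1+ a ] + + suc (a ℕ.+ a)) n
  d∣sₐ = subst (λ j → s (+ a) n ∣ s j n) (sym (-[1+a]+[1+a+c]≡c a a)) ∣-refl
  value : -[1+ a ] + + (suc b ℕ.* suc (a ℕ.+ a)) ≡ + (a ℕ.+ b ℕ.* suc (a ℕ.+ a))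
  value = trans (cong (λ m → -[1+ a ] + + suc m) (ℕ.+-assoc a a (b ℕ.* suc (a ℕ.+ a))))
    (-[1+a]+[1+a+c]≡c a (a ℕ.+ b ℕ.* suc (a ℕ.+ a)))

y<ny-x : ∀ {n x y} → + 2 ≤ n → 0ℤ ≤ x → x < y → y < n * y - x
y<ny-x {n} {x} {y} 2≤n 0≤x x<y = begin-strict
  y              ≡⟨ y≡y+x-x y x ⟩
  y + x - x      <⟨ ℤ.+-monoˡ-< (- x) (ℤ.+-monoʳ-< y x<y) ⟩
  y + y - x      ≡⟨ cong (_- x) (y+y≡2y y) ⟩
  + 2 * y - x    ≤⟨ ℤ.+-monoˡ-≤ (- x) (ℤ.*-monoʳ-≤-nonNeg y {{nonNegative 0≤y}} 2≤n) ⟩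
  n * y - x      ∎
  where
  open ℤ.≤-Reasoning
  0≤y : 0ℤ ≤ y
  0≤y = ℤ.≤-trans 0≤x (ℤ.<⇒≤ x<y)
  y≡y+x-x : ∀ y x → y ≡ y + x - x
  y≡y+x-x = solve-∀
  y+y≡2y : ∀ y → y + y ≡ + 2 * y
  y+y≡2y = solve-∀

s-positive-increasing : + 2 ≤ n → ∀ k → 0ℤ < s (+ k) n × s (+ k) n < s (+ suc k) n
s-positive-increasing 2≤n zero = +<+ z<s , ℤ.+-monoˡ-< 1ℤ (ℤ.<-≤-trans (+<+ z<s) 2≤n)
s-positive-increasing 2≤n (suc k) with s-positive-increasing 2≤n k
... | 0<sₖ , sₖ<sₖ₊₁ = ℤ.<-trans 0<sₖ sₖ<sₖ₊₁ , y<ny-x 2≤n (ℤ.<⇒≤ 0<sₖ) sₖ<sₖ₊₁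

s-strictMono : + 2 ≤ n → ∀ {a b} → a ℕ.< b → s (+ a) n < s (+ b) n
s-strictMono 2≤n {b = suc b} a<1+b with ℕ.m<1+n⇒m<n∨m≡n a<1+b
... | inj₁ a<b = ℤ.<-trans (s-strictMono 2≤n a<b) (proj₂ (s-positive-increasing 2≤n b))
... | inj₂ refl = proj₂ (s-positive-increasing 2≤n b)

s-negative : + 2 ≤ n → ∀ k → s -[1+ k ] n < 0ℤ
s-negative {n} 2≤n k = subst (_< 0ℤ) (sym (s-reflection n k)) (ℤ.neg-mono-< (proj₁ (s-positive-increasing 2≤n k)))

parity[1+k+k]≡1ℙ : ∀ k → parity (suc (k ℕ.+ k)) ≡ 1ℙ
parity[1+k+k]≡1ℙ zero = refl
parity[1+k+k]≡1ℙ (suc k) rewrite ℕ.+-suc k k = parity[1+k+k]≡1ℙ k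

1+k+k≢2 : ∀ k → suc (k ℕ.+ k) ≢ 2
1+k+k≢2 k eq with trans (sym (parity[1+k+k]≡1ℙ k)) (cong parity eq)
... | ()

parity≡1ℙ⇒odd : ∀ d → parity d ≡ 1ℙ → d ≡ suc (⌊ d /2⌋ ℕ.+ ⌊ d /2⌋)
parity≡1ℙ⇒odd (suc zero) _ = refl
parity≡1ℙ⇒odd (suc (suc d)) odd =
  cong (suc ∘ suc) (trans (parity≡1ℙ⇒odd d odd) (sym (ℕ.+-suc ⌊ d /2⌋ ⌊ d /2⌋)))

parity-*≡1ℙ : ∀ d e → parity (d ℕ.* e) ≡ 1ℙ → parity d ≡ 1ℙ × parity e ≡ 1ℙ
parity-*≡1ℙ d e eq with parity d | parity e | trans (sym (*-homo-* d e)) eq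
... | 1ℙ | 1ℙ | _ = refl , refl

1<1+a+a⇒0<a : ∀ {a} → 1 ℕ.< suc (a ℕ.+ a) → 0 ℕ.< a
1<1+a+a⇒0<a {zero} (ℕ.s≤s ())
1<1+a+a⇒0<a {suc a} _ = z<s

d<[1+b+b]*d⇒0<b : ∀ {b d} → d ℕ.< suc (b ℕ.+ b) ℕ.* d → 0 ℕ.< b
d<[1+b+b]*d⇒0<b {zero} {d} d<d+0 = ⊥-elim (ℕ.<-irrefl (sym (ℕ.+-identityʳ d)) d<d+0)
d<[1+b+b]*d⇒0<b {suc b} _ = z<s

m+m≡n+n⇒m≡n : ∀ {m n} → m ℕ.+ m ≡ n ℕ.+ n → m ≡ n
m+m≡n+n⇒m≡n {m} {n} eq = trans (ℕ.n≡⌊n+n/2⌋ m) (trans (cong ⌊_/2⌋ eq) (sym (ℕ.n≡⌊n+n/2⌋ n)))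

odd-product : ∀ a b → suc (b ℕ.+ b) ℕ.* suc (a ℕ.+ a) ≡
  suc ((a ℕ.+ b ℕ.* suc (a ℕ.+ a)) ℕ.+ (a ℕ.+ b ℕ.* suc (a ℕ.+ a)))
odd-product = ℕ-Solver.solve-∀

composite[1+k+k]⇒factorisation : ∀ {k} → Composite (suc (k ℕ.+ k)) →
  ∃₂ λ a b → 0 ℕ.< a × 0 ℕ.< b × k ≡ a ℕ.+ b ℕ.* suc (a ℕ.+ a)
composite[1+k+k]⇒factorisation {k} (composite {d} d<q (divides e q≡e*d))
  with parity-*≡1ℙ e d (trans (cong parity (sym q≡e*d)) (parity[1+k+k]≡1ℙ k))
... | odd-e , odd-d = a , b , 0<a , 0<b , k≡
  where
  a b : ℕ
  a = ⌊ d /2⌋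
  b = ⌊ e /2⌋
  d≡ : d ≡ suc (a ℕ.+ a)
  d≡ = parity≡1ℙ⇒odd d odd-d
  e≡ : e ≡ suc (b ℕ.+ b)
  e≡ = parity≡1ℙ⇒odd e odd-e
  0<a : 0 ℕ.< a
  0<a = 1<1+a+a⇒0<a (subst (1 ℕ.<_) d≡ (ℕ.nonTrivial⇒n>1 d))
  0<b : 0 ℕ.< b
  0<b = d<[1+b+b]*d⇒0<b (subst (λ e → d ℕ.< e ℕ.* d) e≡ (subst (d ℕ.<_) q≡e*d d<q))
  k≡ : k ≡ a ℕ.+ b ℕ.* suc (a ℕ.+ a)
  k≡ = m+m≡n+n⇒m≡n (ℕ.suc-injective (trans q≡e*d (trans (cong₂ ℕ._*_ e≡ d≡) (odd-product a b))))

prime⇒¬∣ : ∀ {p d} → Prime p → 1ℤ < d → d < + p → ¬ (d ∣ + p)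
prime⇒¬∣ {p} {d} pp 1<d d<p d∣p
  with prime⇒irreducible pp (∣⇒∣ᵤ d∣p) | ℤ.0≤i⇒+∣i∣≡i (ℤ.<⇒≤ (ℤ.<-trans (+<+ z<s) 1<d))
... | inj₁ ∣d∣≡1 | +∣d∣≡d = ℤ.<-irrefl (trans (cong +_ (sym ∣d∣≡1)) +∣d∣≡d) 1<d
... | inj₂ ∣d∣≡p | +∣d∣≡d = ℤ.<-irrefl (trans (sym +∣d∣≡d) (cong +_ ∣d∣≡p)) d<p

s-prime⇒¬composite : + 2 ≤ n → ∀ {k p} → Prime p → s (+ k) n ≡ + p → ¬ Composite (suc (k ℕ.+ k))
s-prime⇒¬composite {n} 2≤n {k} {p} pp sₖ≡p c with composite[1+k+k]⇒factorisation {k} c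
... | _ , zero , _ , () , _
... | a , suc b , 0<a , _ , refl = prime⇒¬∣ pp 1<sₐ sₐ<p (subst (s (+ a) n ∣_) sₖ≡p (s[a]∣s[a+b*[1+a+a]] n a (suc b)))
  where
  1<sₐ : 1ℤ < s (+ a) n
  1<sₐ = s-strictMono 2≤n 0<a
  sₐ<p : s (+ a) n < + p
  sₐ<p = subst (s (+ a) n <_) sₖ≡p (s-strictMono 2≤n (ℕ.m<m+n a z<s))

2k+1≡1+k+k : ∀ k → 2 ℕ.* k ℕ.+ 1 ≡ suc (k ℕ.+ k)
2k+1≡1+k+k = ℕ-Solver.solve-∀

lemma26 : (n k : ℤ) → + 2 ≤ n → (p : ℕ) → Prime p → s k n ≡ + p →
    Σ ℕ (λ q → Prime q × q ≢ 2 × + 2 * k + + 1 ≡ + q)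
lemma26 n -[1+ k ] 2≤n p _ sₖ≡p = ⊥-elim (ℤ.+≮0 (subst (_< 0ℤ) sₖ≡p (s-negative 2≤n k)))
lemma26 n (+ zero) _ p pp 1≡p = ⊥-elim (¬prime[1] (subst Prime (sym (ℤ.+-injective 1≡p)) pp))
lemma26 n (+ suc j) 2≤n p pp sₖ≡p =
  suc (k ℕ.+ k) , prime (s-prime⇒¬composite 2≤n {k} pp sₖ≡p) , 1+k+k≢2 k , cong +_ (2k+1≡1+k+k k)
  where
  k : ℕ
  k = suc j
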